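{- Let $n\ge 1$ and let $\pi=\pi(1)\pi(2)\cdots\pi(n)\in S_n^3$ be a $3$-colored permutation. Let $P_n^3$ be the set of integer partitions $\lambda=(\lambda_1\ge\lambda_2\ge\cdots\ge\lambda_n\ge 0)$ with at most $n$ parts in which every part $\lambda_i$ is divisible by $3$, and let $Q_\pi$ be the set of standard labeled partitions $(\mu,\pi)$ (with $\mu$ a partition with at most $n$ parts, $\mu=(\mu_1\ge\cdots\ge\mu_n\ge 0)$) such that $\mu_i-c(\pi(i))$ is divisible by $3$ for every $i\in[n]$. Then there is a bijection $g_\pi\colon P_n^3\to Q_\pi$, $\lambda\mapsto(\mu,\pi)$, such that \[|\lambda|+\mathrm{fmaj}_3(\pi)=|\mu|.\]
   Context: A $3$-colored permutation in $S_n^3$ is a word $\pi(1)_{c_1}\pi(2)_{c_2}\cdots\pi(n)_{c_n}$ where $\pi(1)\cdots\pi(n)$ is a permutation of $[n]=\{1,\dots,n\}$ and each color (subscript) $c_i\in\{0,1,2\}$; for a colored letter $w_j$ we write $c(w_j)=j$ for its color. Colored letters are totally ordered by $1_2<2_2<\cdots<n_2<1_1<2_1<\cdots<n_1<1_0<2_0<\cdots<n_0$. The descent set is $D(\pi)=\{i\in[n-1]:\pi(i)>\pi(i+1)\}$ (with respect to this order), $\mathrm{maj}(\pi)=\sum_{i\in D(\pi)}i$, $N_j(\pi)$ is the number of letters of $\pi$ with color $j$, and $\mathrm{fmaj}_3(\pi)=3\,\mathrm{maj}(\pi)+N_1(\pi)+2N_2(\pi)$. For a partition $\lambda$, $|\lambda|=\lambda_1+\cdots+\lambda_n$.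 A labeled partition is a pair $(\mu,\pi)$ with $\mu=(\mu_1\ge\cdots\ge\mu_n\ge0)$ a partition with at most $n$ parts and $\pi\in S_n^3$; it is standard if for every $i\in[n-1]$, $\pi(i)>\pi(i+1)$ implies $\mu_i>\mu_{i+1}$. -}

module Defs where

open import Data.Nat using (ℕ; zero; suc; _+_; _*_; _≤_; _<_; _<ᵇ_; _≡ᵇ_)
open import Data.Bool using (Bool; true; false; _∨_; _∧_; if_then_else_)
open import Data.Fin using (Fin; toℕ)
open import Data.Fin.Permutation using (Permutation′; _⟨$⟩ʳ_)
open import Data.List using (List; []; _∷_; map; length; filter; allFin)
open import Data.Nat.ListAction using (sum)
open import Data.Vec using (Vec; lookup; toList)
open import Data.Product using (_×_; _,_; proj₂)
open import Relation.Binary.PropositionalEquality using (_≡_)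
open import Data.Integer using (ℤ; +_; _-_)
open import Data.Integer.Divisibility using (_∣_)
open import Data.Fin using (_≟_)

-- A 3-colored permutation in S_n^3: a permutation of [n] (positions and values
-- are 0-indexed as Fin n) together with a color in {0,1,2} for each position.
record ColPerm (n : ℕ) : Set where
  field
    perm  : Permutation′ n
    color : Fin n → Fin 3
open ColPerm public

Letter : ℕ → Set
Letter n = Fin n × Fin 3

-- Strict order on colored letters:
-- 1_2 < ... < n_2 < 1_1 < ... < n_1 < 1_0 < ... < n_0.
-- (a , c) < (b , d)  iff  d < c, or (c = d and a < b).
_<ᶜ_ : ∀ {n} → Letter n → Letter n → Bool
(a , c) <ᶜ (b , d) = (toℕ d <ᵇ toℕ c) ∨ ((toℕ c ≡ᵇ toℕ d) ∧ (toℕ a <ᵇ toℕ b))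

letter : ∀ {n} → ColPerm n → Fin n → Letter n
letter π i = (perm π ⟨$⟩ʳ i , color π i)

word : ∀ {n} → ColPerm n → List (Letter n)
word {n} π = map (letter π) (allFin n)

majAux : ∀ {n} → ℕ → List (Letter n) → ℕ
majAux k []            = 0
majAux k (x ∷ [])      = 0
majAux k (x ∷ y ∷ ws)  = (if y <ᶜ x then k else 0) + majAux (suc k) (y ∷ ws)

-- maj(π) = sum of descents i ∈ [n-1] (1-indexed positions).
maj : ∀ {n} → ColPerm n → ℕ
maj π = majAux 1 (word π)

N : ∀ {n} → Fin 3 → ColPerm n → ℕ
N {n} j π = length (filter (λ i → color π i ≟ j) (allFin n))

fmaj3 : ∀ {n} → ColPerm n → ℕ
fmaj3 π = 3 * maj π + N (Fin.suc Fin.zero) π + 2 * N (Fin.suc (Fin.suc Fin.zero)) π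
  where import Data.Fin as Fin

-- Sequences of n natural numbers (candidate partitions with at most n parts).
-- |λ| = λ_1 + ... + λ_n
∣_∣ₚ : ∀ {n} → Vec ℕ n → ℕ
∣ v ∣ₚ = sum (toList v)

IsPartition : ∀ {n} → Vec ℕ n → Set
IsPartition {n} v = (i j : Fin n) → toℕ j ≡ suc (toℕ i) → lookup v j ≤ lookup v i

InP3 : ∀ {n} → Vec ℕ n → Set
InP3 {n} v = IsPartition v × ((i : Fin n) → (+ 3) ∣ (+ lookup v i))

IsStandard : ∀ {n} → Vec ℕ n → ColPerm n → Set
IsStandard {n} μ π = (i j : Fin n) → toℕ j ≡ suc (toℕ i) →
  (letter π j <ᶜ letter π i) ≡ true → lookup μ j < lookup μ i

InQ : ∀ {n} → ColPerm n → Vec ℕ n → Set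
InQ {n} π μ = IsPartition μ × IsStandard μ π
  × ((i : Fin n) → (+ 3) ∣ (+ lookup μ i - + toℕ (color π i)))

-- The bijection g_π : P_n^3 → Q_π, λ ↦ λ + s, where s is the shift vector
--   s_i = c_i + 3 d_i,   c_i = colour of the i-th letter,
--                        d_i = number of descents of π at positions ≥ i.
--
-- Both sets are described through quotients by 3.  A vector of P_n^3 is 3t
-- with t weakly decreasing.  A vector μ lies in Q_π iff μ_i = c_i + 3 q_i
-- where q is "admissible": q_{i+1} + [descent at i] ≤ q_i (this is the
-- adjacent-pair analysis, since c_i ≤ 2 and at a descent the colour cannot
-- decrease while at an ascent it cannot increase).  The descent counts d are
-- admissible with equality, d_i = [descent at i] + d_{i+1}, so t ↦ t + d maps
-- decreasing sequences onto admissible ones, with inverse q ↦ q ∸ d (every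
-- admissible q dominates d, by downward induction from the last position).
-- Finally |s| = fmaj_3(π): Σ_i d_i = maj(π) since a descent at position p is
-- counted by d_1, …, d_p, and Σ_i c_i = N_1(π) + 2 N_2(π).
module Submission where

open import Defs
open import Data.Nat using (ℕ; _≤_; _+_)
open import Data.Vec using (Vec)
open import Data.Product using (Σ; _×_)
open import Relation.Binary.PropositionalEquality using (_≡_)

open import Data.Bool using (true; false; if_then_else_; T)
open import Data.Empty using (⊥-elim)
open import Data.Fin using (Fin; zero; suc; toℕ; fromℕ; _≟_)
open import Data.Fin.Properties using (toℕ<n)
open import Data.Integer using (+_; _-_; ∣_∣)
open import Data.Integer.Properties using (m-n≡m⊖n; ⊖-≥; ∣⊖∣-<)
import Data.Integer.Divisibility as ℤ
import Data.List as List
open import Data.List using (List; []; _∷_; filter; length; allFin)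
open import Data.List.Properties using (map-tabulate)
import Data.Nat as ℕ
open import Data.Nat using (_*_; _∸_; _<_; _<ᵇ_; _≡ᵇ_; z≤n; s≤s⁻¹; >-nonZero; _≤?_)
open import Data.Nat.Divisibility using (_∣_; ∣⇒≤; m∣m*n)
open import Data.Nat.ListAction using (sum)
open import Data.Nat.Properties hiding (_≟_)
open import Data.Nat.Tactic.RingSolver using (solve-∀)
open import Data.Product using (_,_; proj₁; proj₂)
open import Data.Vec using ([]; _∷_; lookup; zipWith; tabulate)
open import Data.Vec.Properties using (lookup-zipWith; lookup∘tabulate; tabulate∘lookup; tabulate-cong)
open import Function using (_∘_; id)
open import Relation.Binary.PropositionalEquality using (refl; sym; trans; cong; cong₂; subst; subst₂; module ≡-Reasoning)
open import Relation.Nullary using (yes; no)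

Adjacent : ∀ {m} → Fin m → Fin m → Set
Adjacent i j = toℕ j ≡ ℕ.suc (toℕ i)

∑ : ∀ {m} → (Fin m → ℕ) → ℕ
∑ h = sum (List.tabulate h)

∑-linear : ∀ {m} k (a b : Fin m → ℕ) → ∑ (λ i → a i + k * b i) ≡ ∑ a + k * ∑ b
∑-linear {ℕ.zero} k a b = sym (*-zeroʳ k)
∑-linear {ℕ.suc m} k a b =
  trans (cong (_+_ (a zero + k * b zero)) (∑-linear k (a ∘ suc) (b ∘ suc)))
        (regroup (a zero) (b zero) (∑ (a ∘ suc)) (∑ (b ∘ suc)) k)
  where
  regroup : ∀ x y u v k → x + k * y + (u + k * v) ≡ x + u + k * (y + v)
  regroup = solve-∀

col : ∀ {k} → Letter k → ℕ
col (_ , c) = toℕ c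

col≤2 : ∀ {k} (x : Letter k) → col x ≤ 2
col≤2 (_ , c) = s≤s⁻¹ (toℕ<n c)

descent : ∀ {k} → Letter k → Letter k → ℕ
descent x y = if y <ᶜ x then 1 else 0

-- Colour is the primary key of the letter order (higher colour = smaller):
-- across a descent the colour weakly increases, across an ascent it weakly
-- decreases.
descent-colour : ∀ {k} (x y : Letter k) → (y <ᶜ x) ≡ true → col x ≤ col y
descent-colour (_ , d) (_ , c) y<x with toℕ d <ᵇ toℕ c in lt | toℕ c ≡ᵇ toℕ d in eq
... | true  | _    = <⇒≤ (<ᵇ⇒< (toℕ d) (toℕ c) (subst T (sym lt) _))
... | false | true = ≤-reflexive (sym (≡ᵇ⇒≡ (toℕ c) (toℕ d) (subst T (sym eq) _)))
descent-colour (_ , d) (_ , c) () | false | false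

ascent-colour : ∀ {k} (x y : Letter k) → (y <ᶜ x) ≡ false → col y ≤ col x
ascent-colour (_ , d) (_ , c) y≮x with toℕ d <ᵇ toℕ c in lt
... | false = ≮⇒≥ (λ d<c → subst T lt (<⇒<ᵇ d<c))
ascent-colour (_ , d) (_ , c) () | true

descents : ∀ {k m} → (Fin m → Letter k) → ℕ
descents {m = ℕ.zero}          f = 0
descents {m = ℕ.suc ℕ.zero}    f = 0
descents {m = ℕ.suc (ℕ.suc m)} f = descent (f zero) (f (suc zero)) + descents (f ∘ suc)

descentsFrom : ∀ {k m} → (Fin m → Letter k) → Fin m → ℕ
descentsFrom f zero    = descents f
descentsFrom f (suc i) = descentsFrom (f ∘ suc) i

descentsFrom-step : ∀ {k m} (f : Fin m → Letter k) (i j : Fin m) → Adjacent i j →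
                    descentsFrom f i ≡ descent (f i) (f j) + descentsFrom f j
descentsFrom-step f zero    (suc zero)    refl = refl
descentsFrom-step f (suc i) (suc j)       e    = descentsFrom-step (f ∘ suc) i j (suc-injective e)
descentsFrom-step f zero    (suc (suc j)) ()
descentsFrom-step f _       zero          ()

descentsFrom-last : ∀ {k m} (f : Fin (ℕ.suc m) → Letter k) → descentsFrom f (fromℕ m) ≡ 0
descentsFrom-last {m = ℕ.zero}  f = refl
descentsFrom-last {m = ℕ.suc m} f = descentsFrom-last (f ∘ suc)

-- majAux counts a descent at offset p with weight (c + 1 + p); splitting the
-- weight, this is c·(#descents) plus Σ_i d_i (a descent at offset p lies in
-- the suffixes starting at offsets 0, …, p).
majAux-tabulate : ∀ {k m} c (f : Fin m → Letter k) →
                  majAux (ℕ.suc c) (List.tabulate f) ≡ c * descents f + ∑ (descentsFrom f)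
majAux-tabulate {m = ℕ.zero}          c f = sym (trans (+-identityʳ (c * 0)) (*-zeroʳ c))
majAux-tabulate {m = ℕ.suc ℕ.zero}    c f = sym (trans (+-identityʳ (c * 0)) (*-zeroʳ c))
majAux-tabulate {m = ℕ.suc (ℕ.suc m)} c f = begin
  (if f (suc zero) <ᶜ f zero then ℕ.suc c else 0) + majAux (ℕ.suc (ℕ.suc c)) (List.tabulate (f ∘ suc))
    ≡⟨ cong₂ _+_ (weight (f (suc zero) <ᶜ f zero)) (majAux-tabulate (ℕ.suc c) (f ∘ suc)) ⟩
  ℕ.suc c * δ + (ℕ.suc c * D + S)
    ≡⟨ regroup c δ D S ⟩
  c * (δ + D) + (δ + D + S) ∎
  where
  open ≡-Reasoning
  δ = descent (f zero) (f (suc zero))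
  D = descents (f ∘ suc)
  S = ∑ (descentsFrom (f ∘ suc))
  weight : ∀ b → (if b then ℕ.suc c else 0) ≡ ℕ.suc c * (if b then 1 else 0)
  weight true  = sym (*-identityʳ (ℕ.suc c))
  weight false = sym (*-zeroʳ (ℕ.suc c))
  regroup : ∀ c δ D S → ℕ.suc c * δ + (ℕ.suc c * D + S) ≡ c * (δ + D) + (δ + D + S)
  regroup = solve-∀

maj≡∑descentsFrom : ∀ {n} (π : ColPerm n) → maj π ≡ ∑ (descentsFrom (letter π))
maj≡∑descentsFrom π =
  trans (cong (majAux 1) (map-tabulate id (letter π))) (majAux-tabulate 0 (letter π))

sum-colours : ∀ {a} {A : Set a} (c : A → Fin 3) (xs : List A) →
  sum (List.map (toℕ ∘ c) xs)
    ≡ length (filter (λ x → c x ≟ suc zero) xs) + 2 * length (filter (λ x → c x ≟ suc (suc zero)) xs)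
sum-colours c [] = refl
sum-colours c (x ∷ xs) with c x | sum-colours c xs
... | zero           | ih = ih
... | suc zero       | ih = cong ℕ.suc ih
... | suc (suc zero) | ih = trans (cong (_+_ 2) ih) (two-more _ _)
  where
  two-more : ∀ u v → 2 + (u + 2 * v) ≡ u + 2 * ℕ.suc v
  two-more = solve-∀

colour-weight : ∀ {n} (π : ColPerm n) →
                N (suc zero) π + 2 * N (suc (suc zero)) π ≡ ∑ (col ∘ letter π)
colour-weight {n} π =
  trans (sym (sum-colours (color π) (allFin n))) (cong sum (map-tabulate id (toℕ ∘ color π)))

shift : ∀ {k m} → (Fin m → Letter k) → Vec ℕ m
shift f = tabulate (λ i → col (f i) + 3 * descentsFrom f i)

∣tabulate∣ : ∀ {m} (h : Fin m → ℕ) → ∣ tabulate h ∣ₚ ≡ ∑ h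
∣tabulate∣ {ℕ.zero}  h = refl
∣tabulate∣ {ℕ.suc m} h = cong (_+_ (h zero)) (∣tabulate∣ (h ∘ suc))

∣zipWith+∣ : ∀ {m} (u v : Vec ℕ m) → ∣ zipWith _+_ u v ∣ₚ ≡ ∣ u ∣ₚ + ∣ v ∣ₚ
∣zipWith+∣ []       []       = refl
∣zipWith+∣ (a ∷ u) (b ∷ v) =
  trans (cong (_+_ (a + b)) (∣zipWith+∣ u v)) (interchange a b ∣ u ∣ₚ ∣ v ∣ₚ)
  where
  interchange : ∀ a b x y → a + b + (x + y) ≡ a + x + (b + y)
  interchange = solve-∀

fmaj3≡∣shift∣ : ∀ {n} (π : ColPerm n) → fmaj3 π ≡ ∣ shift (letter π) ∣ₚ
fmaj3≡∣shift∣ π = begin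
  3 * maj π + N (suc zero) π + 2 * N (suc (suc zero)) π
    ≡⟨ +-assoc (3 * maj π) _ _ ⟩
  3 * maj π + (N (suc zero) π + 2 * N (suc (suc zero)) π)
    ≡⟨ cong₂ (λ a b → 3 * a + b) (maj≡∑descentsFrom π) (colour-weight π) ⟩
  3 * ∑ d + ∑ c
    ≡⟨ +-comm (3 * ∑ d) (∑ c) ⟩
  ∑ c + 3 * ∑ d
    ≡⟨ sym (∑-linear 3 c d) ⟩
  ∑ (λ i → c i + 3 * d i)
    ≡⟨ sym (∣tabulate∣ (λ i → c i + 3 * d i)) ⟩
  ∣ shift (letter π) ∣ₚ ∎
  where
  open ≡-Reasoning
  c = col ∘ letter π
  d = descentsFrom (letter π)

residue-< : ∀ {c c′ q r} → c ≤ 2 → q < r → c + 3 * q < c′ + 3 * r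
residue-< {c} {c′} {q} {r} c≤2 q<r = begin-strict
  c + 3 * q ≤⟨ +-monoˡ-≤ (3 * q) c≤2 ⟩
  2 + 3 * q <⟨ n<1+n _ ⟩
  3 + 3 * q ≡⟨ sym (*-suc 3 q) ⟩
  3 * ℕ.suc q ≤⟨ *-monoʳ-≤ 3 q<r ⟩
  3 * r ≤⟨ m≤n+m (3 * r) c′ ⟩
  c′ + 3 * r ∎
  where open ≤-Reasoning

quotient-≤ : ∀ {c c′ q r} → c ≤ 2 → c′ + 3 * r ≤ c + 3 * q → r ≤ q
quotient-≤ {c} {c′} c≤2 le = ≮⇒≥ (λ q<r → <⇒≱ (residue-< {c′ = c′} c≤2 q<r) le)

quotient-< : ∀ {c c′ q r} → c ≤ c′ → c′ + 3 * r < c + 3 * q → r < q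
quotient-< c≤c′ lt = ≰⇒> (λ q≤r → <⇒≱ lt (+-mono-≤ c≤c′ (*-monoʳ-≤ 3 q≤r)))

StandardPair : ∀ {k} → Letter k → Letter k → ℕ → ℕ → Set
StandardPair x y a b = b ≤ a × ((y <ᶜ x) ≡ true → b < a)

pair-standard : ∀ {k} (x y : Letter k) {q r} →
                r + descent x y ≤ q → StandardPair x y (col x + 3 * q) (col y + 3 * r)
pair-standard x y {q} {r} h with y <ᶜ x in y?x
... | false = +-mono-≤ (ascent-colour x y y?x) (*-monoʳ-≤ 3 (subst (_≤ q) (+-identityʳ r) h)) , λ ()
... | true  = <⇒≤ b<a , λ _ → b<a
  where
  b<a : col y + 3 * r < col x + 3 * q
  b<a = residue-< {c′ = col x} (col≤2 y) (subst (_≤ q) (+-comm r 1) h)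

pair-admissible : ∀ {k} (x y : Letter k) {q r} →
                  StandardPair x y (col x + 3 * q) (col y + 3 * r) → r + descent x y ≤ q
pair-admissible x y {q} {r} (b≤a , desc⇒b<a) with y <ᶜ x in y?x
... | false = subst (_≤ q) (sym (+-identityʳ r)) (quotient-≤ {c′ = col y} {q} {r} (col≤2 x) b≤a)
... | true  = subst (_≤ q) (+-comm 1 r) (quotient-< {q = q} {r} (descent-colour x y y?x) (desc⇒b<a refl))

-- The condition 3 ∣ μ_i - c_i of Q_π is stated in ℤ; for c ≤ a the integer
-- a - c is the natural number a ∸ c.
∣+a-+c∣ : ∀ {a c} → c ≤ a → ∣ + a - + c ∣ ≡ a ∸ c
∣+a-+c∣ {a} {c} c≤a = cong ∣_∣ (trans (m-n≡m⊖n a c) (⊖-≥ c≤a))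

residue-divisible : ∀ c q → + 3 ℤ.∣ (+ (c + 3 * q) - + c)
residue-divisible c q =
  subst (3 ∣_) (sym (trans (∣+a-+c∣ (m≤m+n c (3 * q))) (m+n∸m≡n c (3 * q)))) (m∣m*n q)

residue-quotient : ∀ {a c} → c ≤ 2 → + 3 ℤ.∣ (+ a - + c) → Σ ℕ (λ q → a ≡ c + 3 * q)
residue-quotient {a} {c} c≤2 3∣a-c with c ≤? a
... | yes c≤a = q , (begin
    a           ≡⟨ sym (m+[n∸m]≡n c≤a) ⟩
    c + (a ∸ c) ≡⟨ cong (_+_ c) (trans equality (*-comm q 3)) ⟩
    c + 3 * q   ∎)
  where
  open ≡-Reasoning
  open _∣_ (subst (3 ∣_) (∣+a-+c∣ c≤a) 3∣a-c) renaming (quotient to q)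
... | no c≰a = ⊥-elim (<⇒≱ (n<1+n 2) (≤-trans 3≤c∸a (≤-trans (m∸n≤m c a) c≤2)))
  where
  a<c : a < c
  a<c = ≰⇒> c≰a
  3≤c∸a : 3 ≤ c ∸ a
  3≤c∸a = ∣⇒≤ ⦃ >-nonZero (m<n⇒0<n∸m a<c) ⦄
               (subst (3 ∣_) (trans (cong ∣_∣ (m-n≡m⊖n a c)) (∣⊖∣-< a<c)) 3∣a-c)

HasQuotients : ∀ {k m} → (Fin m → Letter k) → Vec ℕ m → (Fin m → ℕ) → Set
HasQuotients f μ q = ∀ i → lookup μ i ≡ col (f i) + 3 * q i

Admissible : ∀ {k m} → (Fin m → Letter k) → (Fin m → ℕ) → Set
Admissible f q = ∀ i j → Adjacent i j → q j + descent (f i) (f j) ≤ q i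

Decreasing : ∀ {m} → (Fin m → ℕ) → Set
Decreasing t = ∀ i j → Adjacent i j → t j ≤ t i

quotients⇒InQ : ∀ {n} (π : ColPerm n) {μ q} →
                HasQuotients (letter π) μ q → Admissible (letter π) q → InQ π μ
quotients⇒InQ π {μ} {q} μ≡ adm =
  (λ i j e → proj₁ (pair i j e)) , (λ i j e → proj₂ (pair i j e)) , divisible
  where
  pair : ∀ i j → Adjacent i j → StandardPair (letter π i) (letter π j) (lookup μ i) (lookup μ j)
  pair i j e = subst₂ (StandardPair (letter π i) (letter π j)) (sym (μ≡ i)) (sym (μ≡ j))
                 (pair-standard (letter π i) (letter π j) (adm i j e))
  divisible : ∀ i → + 3 ℤ.∣ (+ lookup μ i - + toℕ (color π i))
  divisible i = subst (λ v → + 3 ℤ.∣ (+ v - + toℕ (color π i))) (sym (μ≡ i))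
                  (residue-divisible (toℕ (color π i)) (q i))

InQ⇒quotients : ∀ {n} (π : ColPerm n) {μ} → InQ π μ →
                Σ (Fin n → ℕ) (λ q → HasQuotients (letter π) μ q × Admissible (letter π) q)
InQ⇒quotients {n} π {μ} (partition , standard , divisible) = q , μ≡ , adm
  where
  quotient : ∀ i → Σ ℕ (λ q → lookup μ i ≡ toℕ (color π i) + 3 * q)
  quotient i = residue-quotient (col≤2 (letter π i)) (divisible i)
  q : Fin n → ℕ
  q = proj₁ ∘ quotient
  μ≡ : HasQuotients (letter π) μ q
  μ≡ = proj₂ ∘ quotient
  adm : Admissible (letter π) q
  adm i j e = pair-admissible (letter π i) (letter π j)
                (subst₂ (StandardPair (letter π i) (letter π j)) (μ≡ i) (μ≡ j)
                  (partition i j e , standard i j e))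

InP3⇒thirds : ∀ {n} {l : Vec ℕ n} → InP3 l →
              Σ (Fin n → ℕ) (λ t → (∀ i → lookup l i ≡ 3 * t i) × Decreasing t)
InP3⇒thirds {n} {l} (partition , divisible) = t , l≡3t , decreasing
  where
  t : Fin n → ℕ
  t i = _∣_.quotient (divisible i)
  l≡3t : ∀ i → lookup l i ≡ 3 * t i
  l≡3t i = trans (_∣_.equality (divisible i)) (*-comm (t i) 3)
  decreasing : Decreasing t
  decreasing i j e = *-cancelˡ-≤ 3 (subst₂ _≤_ (l≡3t j) (l≡3t i) (partition i j e))

thirds⇒InP3 : ∀ {n} {t : Fin n → ℕ} → Decreasing t → InP3 (tabulate (λ i → 3 * t i))
thirds⇒InP3 {t = t} decreasing = partition , divisible
  where
  l≡3t : ∀ i → lookup (tabulate (λ i → 3 * t i)) i ≡ 3 * t i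
  l≡3t = lookup∘tabulate (λ i → 3 * t i)
  partition : IsPartition (tabulate (λ i → 3 * t i))
  partition i j e = subst₂ _≤_ (sym (l≡3t j)) (sym (l≡3t i)) (*-monoʳ-≤ 3 (decreasing i j e))
  divisible : ∀ i → + 3 ℤ.∣ (+ lookup (tabulate (λ i → 3 * t i)) i)
  divisible i = subst (3 ∣_) (sym (l≡3t i)) (m∣m*n (t i))

descentsFrom-admissible : ∀ {k m} (f : Fin m → Letter k) → Admissible f (descentsFrom f)
descentsFrom-admissible f i j e =
  ≤-reflexive (trans (+-comm (descentsFrom f j) _) (sym (descentsFrom-step f i j e)))

admissible+decreasing : ∀ {k m} (f : Fin m → Letter k) {q t} → Admissible f q → Decreasing t →
                        Admissible f (λ i → t i + q i)
admissible+decreasing f {q} {t} adm dec i j e =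
  subst (_≤ t i + q i) (sym (+-assoc (t j) (q j) _)) (+-mono-≤ (dec i j e) (adm i j e))

admissible∸descents : ∀ {k m} (f : Fin m → Letter k) {q} → Admissible f q →
                      Decreasing (λ i → q i ∸ descentsFrom f i)
admissible∸descents f {q} adm i j e = begin
  q j ∸ descentsFrom f j             ≡⟨ sym ([m+n]∸[m+o]≡n∸o δ (q j) (descentsFrom f j)) ⟩
  (δ + q j) ∸ (δ + descentsFrom f j) ≤⟨ ∸-monoˡ-≤ (δ + descentsFrom f j) δ+qj≤qi ⟩
  q i ∸ (δ + descentsFrom f j)       ≡⟨ cong (q i ∸_) (sym (descentsFrom-step f i j e)) ⟩
  q i ∸ descentsFrom f i             ∎
  where
  open ≤-Reasoning
  δ = descent (f i) (f j)
  δ+qj≤qi : δ + q j ≤ q i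
  δ+qj≤qi = subst (_≤ q i) (+-comm (q j) δ) (adm i j e)

downward-induction : ∀ {m} (P : Fin (ℕ.suc m) → Set) → P (fromℕ m) →
                     (∀ i j → Adjacent i j → P j → P i) → ∀ i → P i
downward-induction {ℕ.zero}  P last step zero = last
downward-induction {ℕ.suc m} P last step i    = go i
  where
  later : ∀ i → P (suc i)
  later = downward-induction (P ∘ suc) last (λ i j e → step (suc i) (suc j) (cong ℕ.suc e))
  go : ∀ i → P i
  go zero    = step zero (suc zero) refl (later zero)
  go (suc i) = later i

descentsFrom≤admissible : ∀ {k m} (f : Fin (ℕ.suc m) → Letter k) {q} → Admissible f q →
                          ∀ i → descentsFrom f i ≤ q i
descentsFrom≤admissible {m = m} f {q} adm = downward-induction (λ i → descentsFrom f i ≤ q i) last step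
  where
  last : descentsFrom f (fromℕ m) ≤ q (fromℕ m)
  last = subst (_≤ q (fromℕ m)) (sym (descentsFrom-last f)) z≤n
  step : ∀ i j → Adjacent i j → descentsFrom f j ≤ q j → descentsFrom f i ≤ q i
  step i j e dj≤qj = begin
    descentsFrom f i                        ≡⟨ descentsFrom-step f i j e ⟩
    descent (f i) (f j) + descentsFrom f j  ≤⟨ +-monoʳ-≤ _ dj≤qj ⟩
    descent (f i) (f j) + q j               ≡⟨ +-comm _ (q j) ⟩
    q j + descent (f i) (f j)               ≤⟨ adm i j e ⟩
    q i                                     ∎
    where open ≤-Reasoning

lookup-ext : ∀ {a} {A : Set a} {m} {u v : Vec A m} → (∀ i → lookup u i ≡ lookup v i) → u ≡ v
lookup-ext {u = u} {v} u≗v =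
  trans (sym (tabulate∘lookup u)) (trans (tabulate-cong u≗v) (tabulate∘lookup v))

zipWith-+-cancelʳ : ∀ {m} (u v s : Vec ℕ m) → zipWith _+_ u s ≡ zipWith _+_ v s → u ≡ v
zipWith-+-cancelʳ u v s eq = lookup-ext (λ i → +-cancelʳ-≡ (lookup s i) _ _ (begin
  lookup u i + lookup s i    ≡⟨ sym (lookup-zipWith _+_ i u s) ⟩
  lookup (zipWith _+_ u s) i ≡⟨ cong (λ w → lookup w i) eq ⟩
  lookup (zipWith _+_ v s) i ≡⟨ lookup-zipWith _+_ i v s ⟩
  lookup v i + lookup s i    ∎))
  where open ≡-Reasoning

shifted-residue : ∀ {a} t c d → a ≡ 3 * t → a + (c + 3 * d) ≡ c + 3 * (t + d)
shifted-residue t c d refl = regroup t c d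
  where
  regroup : ∀ t c d → 3 * t + (c + 3 * d) ≡ c + 3 * (t + d)
  regroup = solve-∀

-- g_π λ = λ + s.  The hypothesis n ≥ 1 provides the last position from which
-- the domination q ≥ d is proved by downward induction.
lemma2p2 : (n : ℕ) → 1 ≤ n → (π : ColPerm n) →
    Σ (Vec ℕ n → Vec ℕ n) (λ g →
      ((l : Vec ℕ n) → InP3 l → InQ π (g l) × (∣ l ∣ₚ + fmaj3 π ≡ ∣ g l ∣ₚ))
      × ((l₁ l₂ : Vec ℕ n) → InP3 l₁ → InP3 l₂ → g l₁ ≡ g l₂ → l₁ ≡ l₂)
      × ((μ : Vec ℕ n) → InQ π μ → Σ (Vec ℕ n) (λ l → InP3 l × g l ≡ μ)))
lemma2p2 (ℕ.suc m) _ π = g , forward , injective , surjective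
  where
  f : Fin (ℕ.suc m) → Letter (ℕ.suc m)
  f = letter π
  d : Fin (ℕ.suc m) → ℕ
  d = descentsFrom f
  s : Vec ℕ (ℕ.suc m)
  s = shift f
  g : Vec ℕ (ℕ.suc m) → Vec ℕ (ℕ.suc m)
  g l = zipWith _+_ l s

  g-quotients : ∀ l {t : Fin (ℕ.suc m) → ℕ} → (∀ i → lookup l i ≡ 3 * t i) →
                HasQuotients f (g l) (λ i → t i + d i)
  g-quotients l {t} l≡3t i = begin
    lookup (g l) i                     ≡⟨ lookup-zipWith _+_ i l s ⟩
    lookup l i + lookup s i            ≡⟨ cong (_+_ (lookup l i)) (lookup∘tabulate (λ j → col (f j) + 3 * d j) i) ⟩
    lookup l i + (col (f i) + 3 * d i) ≡⟨ shifted-residue (t i) (col (f i)) (d i) (l≡3t i) ⟩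
    col (f i) + 3 * (t i + d i)        ∎
    where open ≡-Reasoning

  forward : ∀ l → InP3 l → InQ π (g l) × (∣ l ∣ₚ + fmaj3 π ≡ ∣ g l ∣ₚ)
  forward l l∈P with InP3⇒thirds {l = l} l∈P
  ... | t , l≡3t , t-dec =
    quotients⇒InQ π {g l} {λ i → t i + d i} (g-quotients l {t} l≡3t)
                    (admissible+decreasing f {d} {t} (descentsFrom-admissible f) t-dec)
    , trans (cong (_+_ ∣ l ∣ₚ) (fmaj3≡∣shift∣ π)) (sym (∣zipWith+∣ l s))

  injective : ∀ l₁ l₂ → InP3 l₁ → InP3 l₂ → g l₁ ≡ g l₂ → l₁ ≡ l₂
  injective l₁ l₂ _ _ = zipWith-+-cancelʳ l₁ l₂ s

  -- μ = c + 3q with q admissible is the image of 3(q ∸ d), since q ≥ d.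
  surjective : ∀ μ → InQ π μ → Σ (Vec ℕ (ℕ.suc m)) (λ l → InP3 l × g l ≡ μ)
  surjective μ μ∈Q with InQ⇒quotients π {μ} μ∈Q
  ... | q , μ≡ , adm = l , thirds⇒InP3 (admissible∸descents f adm) , lookup-ext pointwise
    where
    t : Fin (ℕ.suc m) → ℕ
    t i = q i ∸ d i
    l : Vec ℕ (ℕ.suc m)
    l = tabulate (λ i → 3 * t i)
    pointwise : ∀ i → lookup (g l) i ≡ lookup μ i
    pointwise i = begin
      lookup (g l) i              ≡⟨ g-quotients l {t} (lookup∘tabulate (λ j → 3 * t j)) i ⟩
      col (f i) + 3 * (t i + d i) ≡⟨ cong (λ x → col (f i) + 3 * x) (m∸n+n≡m (descentsFrom≤admissible f adm i)) ⟩
      col (f i) + 3 * q i         ≡⟨ sym (μ≡ i) ⟩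
      lookup μ i                  ∎
      where open ≡-Reasoning
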